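{- Let $A$ be a connected Nakayama algebra with $n$ simple modules. The following are equivalent: (1) $A$ has finite global dimension and magnitude one; (2) $A$ has a unique indecomposable projective module of ($K$-)dimension $n$; (3) $A$ has finite global dimension and Loewy length at least $n$.
   Context: $K$ is an algebraically closed field; a connected Nakayama algebra with $n$ simple modules is $KQ/I$, $I$ admissible, with $Q$ either the linear quiver $0\to\cdots\to n-1$ or the cyclic quiver $0\to 1\to\cdots\to n-1\to 0$. Its Kupisch series is $[c_0,\dots,c_{n-1}]$, $c_i=\dim_K e_iA$ (the dimensions of the indecomposable projective modules $e_iA$), and its Loewy length is $\max_i c_i$. The Cartan matrix of $A$ is the $n\times n$ matrix with entries $\dim_K e_iAe_j$; when $A$ has finite global dimension it is invertible and the magnitude of $A$ is the sum of all entries of its inverse. -}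

module Defs where

open import Data.Nat using (ℕ; zero; suc; _+_; _∸_; _≤_; _≥_; _⊔_)
open import Data.Nat.DivMod using (_mod_)
open import Data.Fin using (Fin; toℕ; fromℕ; inject₁) renaming (zero to fzero; suc to fsuc)
import Data.Fin as Fin
open import Data.Product using (_×_; _,_; proj₂; ∃; ∃-syntax)
open import Data.Bool using (if_then_else_)
open import Relation.Nullary.Decidable using (⌊_⌋)
open import Relation.Binary.PropositionalEquality using (_≡_; _≢_)
open import Data.Rational as ℚ using (ℚ; 0ℚ; 1ℚ; _*_; _+_)
open import Data.Integer using (+_)
open import Function using (_∘_)

-- Throughout, a connected Nakayama algebra with n = suc m simple modules
-- 0,…,m is given (up to isomorphism) by its quiver type and its
-- Kupisch series c : Fin (suc m) → ℕ, c i = dim_K e_i A.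

data QuiverType : Set where
  linear cyclic : QuiverType

cK : {m : ℕ} → (Fin (suc m) → ℕ) → ℕ → ℕ
cK {m} c i = c (i mod suc m)

IsKupischSeries : (m : ℕ) → QuiverType → (Fin (suc m) → ℕ) → Set
IsKupischSeries m linear c =
  (c (fromℕ m) ≡ 1)
  × (∀ (i : Fin m) → c (inject₁ i) ≥ 2)
  × (∀ (i : Fin m) → c (fsuc i) ≥ c (inject₁ i) ∸ 1)
IsKupischSeries m cyclic c =
  (∀ (i : Fin (suc m)) → c i ≥ 2)
  × (∀ (i : ℕ) → cK c (suc i) ≥ cK c i ∸ 1)

sumℕ : ℕ → (ℕ → ℕ) → ℕ
sumℕ zero f = zero
sumℕ (suc k) f = f zero Data.Nat.+ sumℕ k (f ∘ suc)

sumFinℚ : {n : ℕ} → (Fin n → ℚ) → ℚ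
sumFinℚ {zero} f = 0ℚ
sumFinℚ {suc n} f = f fzero ℚ.+ sumFinℚ (f ∘ fsuc)

maxFin : {n : ℕ} → (Fin n → ℕ) → ℕ
maxFin {zero} f = 0
maxFin {suc n} f = f fzero ⊔ maxFin (f ∘ fsuc)

-- Cartan matrix: C i j = dim_K e_i A e_j = number of composition factors
-- S_j of e_i A, whose composition factors (from the top) are
-- S_i, S_{i+1}, …, S_{i + c_i - 1} (indices mod n).

cartanℕ : {m : ℕ} → (Fin (suc m) → ℕ) → Fin (suc m) → Fin (suc m) → ℕ
cartanℕ {m} c i j =
  sumℕ (c i) (λ k → if ⌊ ((toℕ i Data.Nat.+ k) mod suc m) Fin.≟ j ⌋ then 1 else 0)

cartan : {m : ℕ} → (Fin (suc m) → ℕ) → Fin (suc m) → Fin (suc m) → ℚ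
cartan c i j = + (cartanℕ c i j) ℚ./ 1

Matrix : ℕ → Set
Matrix n = Fin n → Fin n → ℚ

_·_ : {n : ℕ} → Matrix n → Matrix n → Matrix n
(M · N) i j = sumFinℚ (λ k → M i k * N k j)

idMatrix : {n : ℕ} → Matrix n
idMatrix i j = if ⌊ i Fin.≟ j ⌋ then 1ℚ else 0ℚ

IsInverse : {n : ℕ} → Matrix n → Matrix n → Set
IsInverse C M = (∀ i j → (C · M) i j ≡ idMatrix i j) × (∀ i j → (M · C) i j ≡ idMatrix i j)

sumEntries : {n : ℕ} → Matrix n → ℚ
sumEntries M = sumFinℚ (λ i → sumFinℚ (λ j → M i j))

MagnitudeOne : {m : ℕ} → (Fin (suc m) → ℕ) → Set
MagnitudeOne c = ∃[ M ] (IsInverse (cartan c) M × sumEntries M ≡ 1ℚ)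

-- A nonzero uniserial module is determined by its top
-- S_j and its length l ≤ c_j (a quotient of e_j A); we encode it as (j , l),
-- (j , 0) being the zero module.  Its syzygy (kernel of the projective
-- cover e_j A → M) is uniserial with top S_{j+l} and length c_j - l.

syzygy : {m : ℕ} → (Fin (suc m) → ℕ) → ℕ × ℕ → ℕ × ℕ
syzygy c (j , zero) = (j , zero)
syzygy c (j , suc l) = (j Data.Nat.+ suc l , cK c j ∸ suc l)

iterate : {A : Set} → (A → A) → ℕ → A → A
iterate f zero x = x
iterate f (suc k) x = iterate f k (f x)

-- A has finite global dimension iff every simple module S_i = (i , 1)
-- has finite projective dimension, i.e. some syzygy vanishes.
FiniteGlobalDimension : {m : ℕ} → (Fin (suc m) → ℕ) → Set
FiniteGlobalDimension {m} c =
  ∃[ d ] (∀ (i : Fin (suc m)) → proj₂ (iterate (syzygy c) d (toℕ i , 1)) ≡ 0)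

-- Loewy length = maximal length of an indecomposable projective
loewyLength : {m : ℕ} → (Fin (suc m) → ℕ) → ℕ
loewyLength c = maxFin c

module Submission where

-- Residues mod n stand for the simple modules and e_x A for the interval [x, f x) of ℕ, where
-- f x = x + c_x with c extended periodically.  The syzygy of the uniserial module [a, b) is
-- [b, f a), so [a, b) has finite projective dimension iff the f-orbits of a and b meet, and
-- finite global dimension says that the orbits of x and x + 1 meet for every x, say
-- f^(p x) x = f^(q x) (x + 1).
--
-- Counting residue by residue the first p x points of the orbit of x minus the first q x
-- points of the orbit of x + 1 gives the rows of the inverse of the Cartan matrix, so the
-- magnitude is Σp − Σq.  Chaining the meets once around the circle gives a point w with
-- f^(Σp − Σq) w = w + n.  Magnitude one thus means f w = w + n, i.e. the residue of w is
-- full (c = n); and if some c_y ≥ n, a longer cycle would make every step of f at most n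
-- long, forcing c_y = n.
--
-- The orbit of a full residue i is i + kn, and two such orbits never meet; as all orbits
-- meet, there is at most one full residue.  Conversely, if i₀ is the only full residue, the
-- fixed points of the monotone map y ↦ f y − n above i₀ are the points i₀ + kn, and iterating
-- that map from any y reaches one of them; so every orbit runs into that of i₀, which gives
-- finite global dimension and a cycle of length one.

open import Defs
open import Algebra.Bundles using (Semiring; CommutativeRing)
import Algebra.Properties.Semiring.Sum as SemiringSum
open import Data.Bool using (if_then_else_)
open import Data.Empty using (⊥-elim)
open import Data.Fin as Fin using (Fin; toℕ; fromℕ; fromℕ<; inject₁) renaming (zero to fzero; suc to fsuc)
open import Data.Fin.Properties using (toℕ-injective; toℕ-fromℕ<; toℕ-fromℕ; toℕ-inject₁; toℕ<n)
import Data.Integer as ℤ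
import Data.Integer.Properties as ℤ
open import Data.List using (_∷_; [])
open import Data.Nat using (ℕ; zero; suc; _+_; _*_; _∸_; _≤_; _<_; _≥_; z≤n; s≤s; _%_; _/_; _<?_; _≤?_; _⊔_)
import Data.Nat.Coprimality as Coprime
open import Data.Nat.DivMod using (_mod_; m≡m%n+[m/n]*n; [m+kn]%n≡m%n; m<n⇒m%n≡m; m%n<n; %-distribˡ-+; m%n%n≡m%n)
open import Data.Nat.Induction using (<-wellFounded)
open import Data.Nat.Properties
open import Data.Nat.Tactic.RingSolver using (solve)
open import Data.Product using (Σ-syntax; ∃; ∃!; _×_; _,_; proj₁; proj₂)
open import Data.Rational as ℚ using (ℚ; mkℚ; 1ℚ)
import Data.Rational.Properties as ℚ
open import Data.Rational.Solver using (module +-*-Solver)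
open import Data.Sum using (_⊎_; inj₁; inj₂)
open import Function using (_∘_)
open import Function.Bundles using (_⇔_; mk⇔)
open import Induction.WellFounded using (Acc; acc)
open import Relation.Binary.Definitions using (tri<; tri≈; tri>)
open import Relation.Binary.PropositionalEquality
  using (_≡_; refl; sym; trans; cong; cong₂; subst; subst₂; module ≡-Reasoning)
open import Relation.Nullary using (yes; no)
open import Relation.Nullary.Decidable using (⌊_⌋)

open import Algebra.Properties.CommutativeSemigroup +-commutativeSemigroup using (xy∙z≈xz∙y; xy∙z≈x∙zy)
open import Algebra.Properties.Semiring.Sum +-*-semiring using ()
  renaming ( sum to sumFinℕ; sum-cong-≗ to sumFinℕ-cong; ∑-distrib-+ to sumFinℕ-+
           ; sum-replicate-zero to sumFinℕ-zero)

-- Iteration and orbits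

iterate-+ : ∀ {A : Set} (g : A → A) a b x → iterate g (a + b) x ≡ iterate g b (iterate g a x)
iterate-+ g zero    b x = refl
iterate-+ g (suc a) b x = iterate-+ g a b (g x)

iterate-comm : ∀ {A : Set} (g : A → A) a b x → iterate g a (iterate g b x) ≡ iterate g b (iterate g a x)
iterate-comm g a b x = begin
  iterate g a (iterate g b x) ≡⟨ iterate-+ g b a x ⟨
  iterate g (b + a) x         ≡⟨ cong (λ s → iterate g s x) (+-comm b a) ⟩
  iterate g (a + b) x         ≡⟨ iterate-+ g a b x ⟩
  iterate g b (iterate g a x) ∎
  where open ≡-Reasoning

iterate-suc : ∀ {A : Set} (g : A → A) s x → iterate g (suc s) x ≡ g (iterate g s x)
iterate-suc g s x = trans (cong (λ t → iterate g t x) (+-comm 1 s)) (iterate-+ g s 1 x)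

module MonotoneFixedPoint (T : ℕ → ℕ) (T-mono : ∀ {x y} → x ≤ y → T x ≤ T y) where

  FixedPointAbove : ℕ → ℕ → Set
  FixedPointAbove a y = Σ[ s ∈ ℕ ] T (iterate T s y) ≡ iterate T s y × a ≤ iterate T s y

  private
    descend : ∀ {a y} → Acc _<_ y → T a ≡ a → a ≤ y → T y ≤ y → FixedPointAbove a y
    descend {a} {y} (acc rs) Ta a≤y Ty≤y with T y ≟ y
    ... | yes fixed = 0 , fixed , a≤y
    ... | no moves = let s , fixed , a≤ = descend (rs (≤∧≢⇒< Ty≤y moves)) Ta a≤Ty (T-mono Ty≤y)
                     in suc s , fixed , a≤
      where
      a≤Ty : a ≤ T y
      a≤Ty = subst (_≤ T y) Ta (T-mono a≤y)

    ascend : ∀ {b y} → Acc _<_ (b ∸ y) → T b ≡ b → y ≤ b → y ≤ T y → FixedPointAbove y y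
    ascend {b} {y} (acc rs) Tb y≤b y≤Ty with T y ≟ y
    ... | yes fixed = 0 , fixed , ≤-refl
    ... | no moves = let s , fixed , Ty≤ = ascend (rs gap-shrinks) Tb Ty≤b (T-mono y≤Ty)
                     in suc s , fixed , ≤-trans y≤Ty Ty≤
      where
      Ty≤b : T y ≤ b
      Ty≤b = subst (T y ≤_) Tb (T-mono y≤b)
      gap-shrinks : b ∸ T y < b ∸ y
      gap-shrinks = ∸-monoʳ-< (≤∧≢⇒< y≤Ty (moves ∘ sym)) Ty≤b

  reach-fixed-point : ∀ {a b y} → T a ≡ a → T b ≡ b → a ≤ y → y ≤ b → FixedPointAbove a y
  reach-fixed-point {a} {b} {y} Ta Tb a≤y y≤b with ≤-total (T y) y
  ... | inj₁ Ty≤y = descend (<-wellFounded y) Ta a≤y Ty≤y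
  ... | inj₂ y≤Ty = let s , fixed , y≤ = ascend (<-wellFounded (b ∸ y)) Tb y≤b y≤Ty
                    in s , fixed , ≤-trans a≤y y≤

module Orbits (n : ℕ) (f : ℕ → ℕ)
  (f-inflationary : ∀ x → x < f x) (f-mono : ∀ {x y} → x ≤ y → f x ≤ f y)
  (f-shift : ∀ x → f (x + n) ≡ f x + n) where

  f^ : ℕ → ℕ → ℕ
  f^ = iterate f

  f-shiftₖ : ∀ x k → f (x + k * n) ≡ f x + k * n
  f-shiftₖ x zero    = trans (cong f (+-identityʳ x)) (sym (+-identityʳ (f x)))
  f-shiftₖ x (suc k) = begin
    f (x + (n + k * n))  ≡⟨ cong f (+-assoc x n (k * n)) ⟨
    f (x + n + k * n)    ≡⟨ f-shiftₖ (x + n) k ⟩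
    f (x + n) + k * n    ≡⟨ cong (_+ k * n) (f-shift x) ⟩
    f x + n + k * n      ≡⟨ +-assoc (f x) n (k * n) ⟩
    f x + (n + k * n)    ∎
    where open ≡-Reasoning

  f^-shift : ∀ s x k → f^ s (x + k * n) ≡ f^ s x + k * n
  f^-shift zero    x k = refl
  f^-shift (suc s) x k = trans (cong (f^ s) (f-shiftₖ x k)) (f^-shift s (f x) k)

  f^-shift₁ : ∀ s x → f^ s (x + n) ≡ f^ s x + n
  f^-shift₁ zero    x = refl
  f^-shift₁ (suc s) x = trans (cong (f^ s) (f-shift x)) (f^-shift₁ s (f x))

  f^-inflationary : ∀ s x → x ≤ f^ s x
  f^-inflationary zero    x = ≤-refl
  f^-inflationary (suc s) x = ≤-trans (<⇒≤ (f-inflationary x)) (f^-inflationary s (f x))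

  f^-monoˡ : ∀ x {s t} → s ≤ t → f^ s x ≤ f^ t x
  f^-monoˡ x {s} {t} s≤t = begin
    f^ s x                  ≤⟨ f^-inflationary (t ∸ s) (f^ s x) ⟩
    f^ (t ∸ s) (f^ s x)     ≡⟨ iterate-+ f s (t ∸ s) x ⟨
    f^ (s + (t ∸ s)) x      ≡⟨ cong (λ r → f^ r x) (m+[n∸m]≡n s≤t) ⟩
    f^ t x                  ∎
    where open ≤-Reasoning

  f^-strictˡ : ∀ x {s t} → s < t → f^ s x < f^ t x
  f^-strictˡ x {s} {t} s<t = begin-strict
    f^ s x          <⟨ f-inflationary (f^ s x) ⟩
    f (f^ s x)      ≡⟨ iterate-suc f s x ⟨
    f^ (suc s) x    ≤⟨ f^-monoˡ x s<t ⟩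
    f^ t x          ∎
    where open ≤-Reasoning

  f^-injectiveˡ : ∀ x {s t} → f^ s x ≡ f^ t x → s ≡ t
  f^-injectiveˡ x {s} {t} eq with <-cmp s t
  ... | tri< s<t _ _ = ⊥-elim (<-irrefl eq (f^-strictˡ x s<t))
  ... | tri≈ _ s≡t _ = s≡t
  ... | tri> _ _ t<s = ⊥-elim (<-irrefl (sym eq) (f^-strictˡ x t<s))

  Meet : ℕ → ℕ → Set
  Meet a b = Σ[ p ∈ ℕ ] Σ[ q ∈ ℕ ] f^ p a ≡ f^ q b

  Meet-sym : ∀ {a b} → Meet a b → Meet b a
  Meet-sym (p , q , e) = q , p , sym e

  Meet-trans : ∀ {a b c} → Meet a b → Meet b c → Meet a c
  Meet-trans {a} {b} {c} (p , q , e) (p′ , q′ , e′) = p + p′ , q + q′ , (begin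
    f^ (p + p′) a     ≡⟨ iterate-+ f p p′ a ⟩
    f^ p′ (f^ p a)    ≡⟨ cong (f^ p′) e ⟩
    f^ p′ (f^ q b)    ≡⟨ iterate-comm f p′ q b ⟩
    f^ q (f^ p′ b)    ≡⟨ cong (f^ q) e′ ⟩
    f^ q (f^ q′ c)    ≡⟨ iterate-comm f q q′ c ⟩
    f^ q′ (f^ q c)    ≡⟨ iterate-+ f q q′ c ⟨
    f^ (q + q′) c     ∎)
    where open ≡-Reasoning

  Meet-unshift : ∀ {a b} → Meet (a + n) (b + n) → Meet a b
  Meet-unshift {a} {b} (p , q , e) = p , q , +-cancelʳ-≡ n _ _ (begin
    f^ p a + n          ≡⟨ f^-shift₁ p a ⟨
    f^ p (a + n)        ≡⟨ e ⟩
    f^ q (b + n)        ≡⟨ f^-shift₁ q b ⟩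
    f^ q b + n          ∎)
    where open ≡-Reasoning

  meet-chain : ∀ L (u p q : ℕ → ℕ) → (∀ t → f^ (p t) (u t) ≡ f^ (q t) (u (suc t))) →
               f^ (sumℕ L p) (u 0) ≡ f^ (sumℕ L q) (u L)
  meet-chain zero    u p q meets = refl
  meet-chain (suc L) u p q meets = proj₂ (proj₂ (Meet-trans (p 0 , q 0 , meets 0)
    (sumℕ L (p ∘ suc) , sumℕ L (q ∘ suc) , meet-chain L (u ∘ suc) (p ∘ suc) (q ∘ suc) (meets ∘ suc))))

  f^-fixed : ∀ {a} → f a ≡ a + n → ∀ t → f^ t a ≡ a + t * n
  f^-fixed {a} fa zero    = sym (+-identityʳ a)
  f^-fixed {a} fa (suc t) = begin
    f^ t (f a)        ≡⟨ cong (f^ t) fa ⟩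
    f^ t (a + n)      ≡⟨ f^-shift₁ t a ⟩
    f^ t a + n        ≡⟨ cong (_+ n) (f^-fixed fa t) ⟩
    a + t * n + n     ≡⟨ xy∙z≈x∙zy a (t * n) n ⟩
    a + suc t * n     ∎
    where open ≡-Reasoning

  bracket : ∀ {w y} → w ≤ y → Σ[ s ∈ ℕ ] f^ s w ≤ y × y < f^ (suc s) w
  bracket {w} {y} = go (<-wellFounded (y ∸ w))
    where
    go : ∀ {w} → Acc _<_ (y ∸ w) → w ≤ y → Σ[ s ∈ ℕ ] f^ s w ≤ y × y < f^ (suc s) w
    go {w} (acc rs) w≤y with y <? f w
    ... | yes y<fw = 0 , w≤y , y<fw
    ... | no y≮fw = let s , below , above = go (rs (∸-monoʳ-< (f-inflationary w) (≮⇒≥ y≮fw))) (≮⇒≥ y≮fw)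
                    in suc s , below , above

  long-period⇒short-steps : ∀ {w y} d → f^ (suc (suc d)) w ≡ w + n → w ≤ y → f y ≤ y + n
  long-period⇒short-steps {w} {y} d period w≤y with bracket w≤y
  ... | s , ≤y , y< = begin
    f y                          ≤⟨ f-mono (<⇒≤ y<) ⟩
    f (f^ (suc s) w)             ≡⟨ iterate-suc f (suc s) w ⟨
    f^ (suc (suc s)) w           ≤⟨ f^-monoˡ w (s≤s (s≤s (m≤n+m s d))) ⟩
    f^ (suc (suc d) + s) w       ≡⟨ iterate-+ f (suc (suc d)) s w ⟩
    f^ s (f^ (suc (suc d)) w)    ≡⟨ cong (f^ s) period ⟩
    f^ s (w + n)                 ≡⟨ f^-shift₁ s w ⟩
    f^ s w + n                   ≤⟨ +-monoˡ-≤ n ≤y ⟩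
    y + n                        ∎
    where open ≤-Reasoning

common-bound : ∀ {N} (P : Fin N → ℕ → Set) → (∀ i {k l} → k ≤ l → P i k → P i l) →
               (∀ i → ∃ (P i)) → ∃ λ d → ∀ i → P i d
common-bound {zero}  P up witnesses = 0 , λ ()
common-bound {suc N} P up witnesses = k ⊔ d , bound
  where
  k = proj₁ (witnesses fzero)
  rest = common-bound (P ∘ fsuc) (up ∘ fsuc) (witnesses ∘ fsuc)
  d = proj₁ rest
  bound : ∀ i → P i (k ⊔ d)
  bound fzero    = up fzero (m≤m⊔n k d) (proj₂ (witnesses fzero))
  bound (fsuc i) = up (fsuc i) (m≤n⊔m k d) (proj₂ rest i)

maxFin-ub : ∀ {N} (g : Fin N → ℕ) i → g i ≤ maxFin g
maxFin-ub g fzero    = m≤m⊔n _ _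
maxFin-ub g (fsuc i) = ≤-trans (maxFin-ub (g ∘ fsuc) i) (m≤n⊔m _ _)

maxFin-attained : ∀ {N} (g : Fin (suc N) → ℕ) → ∃ λ i → g i ≡ maxFin g
maxFin-attained {zero}  g = fzero , sym (⊔-identityʳ (g fzero))
maxFin-attained {suc N} g with ⊔-sel (g fzero) (maxFin (g ∘ fsuc))
... | inj₁ max≡g0 = fzero , sym max≡g0
... | inj₂ max≡tail = let i , gi≡ = maxFin-attained (g ∘ fsuc) in fsuc i , trans gi≡ (sym max≡tail)

module KroneckerDelta {c ℓ} (R : Semiring c ℓ) where
  private module R = Semiring R
  open R using (Carrier; 0#; 1#; _≈_)
  open import Algebra.Properties.Semiring.Sum R using (sum; sum-cong-≋; sum-cong-≗; sum-replicate-zero)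
  open import Relation.Binary.Reasoning.Setoid R.setoid

  δ : ∀ {N} → Fin N → Fin N → Carrier
  δ r k = if ⌊ r Fin.≟ k ⌋ then 1# else 0#

  δ-suc : ∀ {N} (r k : Fin N) → δ (fsuc r) (fsuc k) ≡ δ r k
  δ-suc r k with r Fin.≟ k
  ... | yes _ = refl
  ... | no _  = refl

  ∑-δˡ : ∀ {N} (r : Fin N) (g : Fin N → Carrier) → sum (λ k → δ r k R.* g k) ≈ g r
  ∑-δˡ {suc N} fzero g = begin
    1# R.* g fzero R.+ sum (λ k → 0# R.* g (fsuc k))
      ≈⟨ R.+-cong (R.*-identityˡ _) (sum-cong-≋ (λ k → R.zeroˡ (g (fsuc k)))) ⟩
    g fzero R.+ sum (λ (_ : Fin N) → 0#)              ≈⟨ R.+-congˡ (sum-replicate-zero N) ⟩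
    g fzero R.+ 0#                                    ≈⟨ R.+-identityʳ _ ⟩
    g fzero                                           ∎
  ∑-δˡ {suc N} (fsuc r) g = begin
    0# R.* g fzero R.+ sum (λ k → δ (fsuc r) (fsuc k) R.* g (fsuc k))
      ≈⟨ R.+-cong (R.zeroˡ _) (R.reflexive (sum-cong-≗ (λ k → cong (R._* g (fsuc k)) (δ-suc r k)))) ⟩
    0# R.+ sum (λ k → δ r k R.* g (fsuc k))           ≈⟨ R.+-identityˡ _ ⟩
    sum (λ k → δ r k R.* g (fsuc k))                  ≈⟨ ∑-δˡ r (g ∘ fsuc) ⟩
    g (fsuc r)                                        ∎

  ∑-δʳ : ∀ {N} (r : Fin N) (g : Fin N → Carrier) → sum (λ k → g k R.* δ k r) ≈ g r
  ∑-δʳ {suc N} fzero g = begin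
    g fzero R.* 1# R.+ sum (λ k → g (fsuc k) R.* 0#)
      ≈⟨ R.+-cong (R.*-identityʳ _) (sum-cong-≋ (λ k → R.zeroʳ (g (fsuc k)))) ⟩
    g fzero R.+ sum (λ (_ : Fin N) → 0#)              ≈⟨ R.+-congˡ (sum-replicate-zero N) ⟩
    g fzero R.+ 0#                                    ≈⟨ R.+-identityʳ _ ⟩
    g fzero                                           ∎
  ∑-δʳ {suc N} (fsuc r) g = begin
    g fzero R.* 0# R.+ sum (λ k → g (fsuc k) R.* δ (fsuc k) (fsuc r))
      ≈⟨ R.+-cong (R.zeroʳ _) (R.reflexive (sum-cong-≗ (λ k → cong (g (fsuc k) R.*_) (δ-suc k r)))) ⟩
    0# R.+ sum (λ k → g (fsuc k) R.* δ k r)           ≈⟨ R.+-identityˡ _ ⟩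
    sum (λ k → g (fsuc k) R.* δ k r)                  ≈⟨ ∑-δʳ r (g ∘ fsuc) ⟩
    g (fsuc r)                                        ∎

open KroneckerDelta +-*-semiring using (δ; ∑-δˡ)

sumℕ-cong : ∀ L {g h : ℕ → ℕ} → (∀ t → g t ≡ h t) → sumℕ L g ≡ sumℕ L h
sumℕ-cong zero    eq = refl
sumℕ-cong (suc L) eq = cong₂ _+_ (eq 0) (sumℕ-cong L (eq ∘ suc))

sumℕ-+ : ∀ a b g → sumℕ (a + b) g ≡ sumℕ a g + sumℕ b (λ t → g (a + t))
sumℕ-+ zero    b g = refl
sumℕ-+ (suc a) b g = trans (cong (g 0 +_) (sumℕ-+ a b (g ∘ suc))) (sym (+-assoc (g 0) _ _))

sumFinℕ-toℕ : ∀ N (g : ℕ → ℕ) → sumFinℕ (λ (x : Fin N) → g (toℕ x)) ≡ sumℕ N g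
sumFinℕ-toℕ zero    g = refl
sumFinℕ-toℕ (suc N) g = cong (g 0 +_) (sumFinℕ-toℕ N (g ∘ suc))

⟦_⟧ : ℕ → ℚ
⟦ a ⟧ = ℤ.+ a ℚ./ 1

private
  ⟦⟧-normal : ∀ a → ⟦ a ⟧ ≡ mkℚ (ℤ.+ a) 0 (Coprime.sym (Coprime.1-coprimeTo a))
  ⟦⟧-normal a = ℚ.normalize-coprime (Coprime.sym (Coprime.1-coprimeTo a))

⟦⟧-+ : ∀ a b → ⟦ a + b ⟧ ≡ ⟦ a ⟧ ℚ.+ ⟦ b ⟧
⟦⟧-+ a b = sym (trans (cong₂ ℚ._+_ (⟦⟧-normal a) (⟦⟧-normal b))
  (cong (ℚ._/ 1) (cong₂ ℤ._+_ (ℤ.*-identityʳ (ℤ.+ a)) (ℤ.*-identityʳ (ℤ.+ b)))))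

⟦⟧-* : ∀ a b → ⟦ a * b ⟧ ≡ ⟦ a ⟧ ℚ.* ⟦ b ⟧
⟦⟧-* a b = sym (trans (cong₂ ℚ._*_ (⟦⟧-normal a) (⟦⟧-normal b)) (cong (ℚ._/ 1) (sym (ℤ.pos-* a b))))

⟦⟧-injective : ∀ {a b} → ⟦ a ⟧ ≡ ⟦ b ⟧ → a ≡ b
⟦⟧-injective {a} {b} eq = cong numerator (trans (sym (⟦⟧-normal a)) (trans eq (⟦⟧-normal b)))
  where
  numerator : ℚ → ℕ
  numerator r = ℤ.∣ ℚ.↥ r ∣

open +-*-Solver using (_:+_; _:-_; _:*_; _:=_) renaming (solve to solveℚ)

⟦m+n⟧-⟦m⟧≡⟦n⟧ : ∀ a d → ⟦ a + d ⟧ ℚ.- ⟦ a ⟧ ≡ ⟦ d ⟧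
⟦m+n⟧-⟦m⟧≡⟦n⟧ a d = trans (cong (ℚ._- ⟦ a ⟧) (⟦⟧-+ a d))
  (solveℚ 2 (λ x y → (x :+ y) :- x := y) refl ⟦ a ⟧ ⟦ d ⟧)

sumFinℚ-cong : ∀ {N} {g h : Fin N → ℚ} → (∀ k → g k ≡ h k) → sumFinℚ g ≡ sumFinℚ h
sumFinℚ-cong {zero}  eq = refl
sumFinℚ-cong {suc N} eq = cong₂ ℚ._+_ (eq fzero) (sumFinℚ-cong (eq ∘ fsuc))

sumFinℚ-⟦⟧-difference : ∀ {N} (a b : Fin N → ℕ) →
  sumFinℚ (λ k → ⟦ a k ⟧ ℚ.- ⟦ b k ⟧) ≡ ⟦ sumFinℕ a ⟧ ℚ.- ⟦ sumFinℕ b ⟧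
sumFinℚ-⟦⟧-difference {zero}  a b = refl
sumFinℚ-⟦⟧-difference {suc N} a b = begin
  (⟦ a fzero ⟧ ℚ.- ⟦ b fzero ⟧) ℚ.+ sumFinℚ (λ k → ⟦ a (fsuc k) ⟧ ℚ.- ⟦ b (fsuc k) ⟧)
    ≡⟨ cong ((⟦ a fzero ⟧ ℚ.- ⟦ b fzero ⟧) ℚ.+_) (sumFinℚ-⟦⟧-difference (a ∘ fsuc) (b ∘ fsuc)) ⟩
  (⟦ a fzero ⟧ ℚ.- ⟦ b fzero ⟧) ℚ.+ (⟦ sumFinℕ (a ∘ fsuc) ⟧ ℚ.- ⟦ sumFinℕ (b ∘ fsuc) ⟧)
    ≡⟨ solveℚ 4 (λ x y u v → (x :- y) :+ (u :- v) := (x :+ u) :- (y :+ v)) refl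
         ⟦ a fzero ⟧ ⟦ b fzero ⟧ ⟦ sumFinℕ (a ∘ fsuc) ⟧ ⟦ sumFinℕ (b ∘ fsuc) ⟧ ⟩
  (⟦ a fzero ⟧ ℚ.+ ⟦ sumFinℕ (a ∘ fsuc) ⟧) ℚ.- (⟦ b fzero ⟧ ℚ.+ ⟦ sumFinℕ (b ∘ fsuc) ⟧)
    ≡⟨ cong₂ ℚ._-_ (⟦⟧-+ (a fzero) _) (⟦⟧-+ (b fzero) _) ⟨
  ⟦ sumFinℕ a ⟧ ℚ.- ⟦ sumFinℕ b ⟧ ∎
  where open ≡-Reasoning

sumFinℚ-⟦⟧-cancel : ∀ {N} (u v : Fin N → ℕ) d → sumFinℕ u ≡ sumFinℕ v + d →
                     sumFinℚ (λ k → ⟦ u k ⟧ ℚ.- ⟦ v k ⟧) ≡ ⟦ d ⟧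
sumFinℚ-⟦⟧-cancel u v d eq = trans (sumFinℚ-⟦⟧-difference u v)
  (trans (cong (λ s → ⟦ s ⟧ ℚ.- ⟦ sumFinℕ v ⟧) eq) (⟦m+n⟧-⟦m⟧≡⟦n⟧ (sumFinℕ v) d))

⟦⟧-difference-*ʳ : ∀ a b w → (⟦ a ⟧ ℚ.- ⟦ b ⟧) ℚ.* ⟦ w ⟧ ≡ ⟦ a * w ⟧ ℚ.- ⟦ b * w ⟧
⟦⟧-difference-*ʳ a b w =
  trans (solveℚ 3 (λ x y z → (x :- y) :* z := x :* z :- y :* z) refl ⟦ a ⟧ ⟦ b ⟧ ⟦ w ⟧)
  (sym (cong₂ ℚ._-_ (⟦⟧-* a w) (⟦⟧-* b w)))

⟦⟧-difference-*ˡ : ∀ w a b → ⟦ w ⟧ ℚ.* (⟦ a ⟧ ℚ.- ⟦ b ⟧) ≡ ⟦ w * a ⟧ ℚ.- ⟦ w * b ⟧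
⟦⟧-difference-*ˡ w a b =
  trans (solveℚ 3 (λ z x y → z :* (x :- y) := z :* x :- z :* y) refl ⟦ w ⟧ ⟦ a ⟧ ⟦ b ⟧)
  (sym (cong₂ ℚ._-_ (⟦⟧-* w a) (⟦⟧-* w b)))

⟦⟧-δ : ∀ {N} (i j : Fin N) → ⟦ δ i j ⟧ ≡ idMatrix i j
⟦⟧-δ i j with i Fin.≟ j
... | yes _ = refl
... | no _  = refl

⟦m⟧-⟦n⟧≡1⇒m≡1+n : ∀ {a b} → ⟦ a ⟧ ℚ.- ⟦ b ⟧ ≡ 1ℚ → a ≡ suc b
⟦m⟧-⟦n⟧≡1⇒m≡1+n {a} {b} eq = ⟦⟧-injective (begin
  ⟦ a ⟧                      ≡⟨ solveℚ 2 (λ x y → x := (x :- y) :+ y) refl ⟦ a ⟧ ⟦ b ⟧ ⟩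
  (⟦ a ⟧ ℚ.- ⟦ b ⟧) ℚ.+ ⟦ b ⟧ ≡⟨ cong (ℚ._+ ⟦ b ⟧) eq ⟩
  ⟦ 1 ⟧ ℚ.+ ⟦ b ⟧            ≡⟨ ⟦⟧-+ 1 b ⟨
  ⟦ suc b ⟧                  ∎)
  where open ≡-Reasoning

⟦1+n⟧-⟦n⟧≡1 : ∀ b → ⟦ suc b ⟧ ℚ.- ⟦ b ⟧ ≡ 1ℚ
⟦1+n⟧-⟦n⟧≡1 b = trans (cong (λ a → ⟦ a ⟧ ℚ.- ⟦ b ⟧) (+-comm 1 b)) (⟦m+n⟧-⟦m⟧≡⟦n⟧ b 1)

ℚ-semiring : Semiring _ _
ℚ-semiring = CommutativeRing.semiring ℚ.+-*-commutativeRing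

module ℚΣ = SemiringSum ℚ-semiring
open KroneckerDelta ℚ-semiring using () renaming (∑-δˡ to ∑ℚ-δˡ; ∑-δʳ to ∑ℚ-δʳ)

sumFinℚ≡∑ : ∀ {N} (g : Fin N → ℚ) → sumFinℚ g ≡ ℚΣ.sum g
sumFinℚ≡∑ {zero}  g = refl
sumFinℚ≡∑ {suc N} g = cong (g fzero ℚ.+_) (sumFinℚ≡∑ (g ∘ fsuc))

·-assoc : ∀ {N} (X Y Z : Matrix N) i j → ((X · Y) · Z) i j ≡ (X · (Y · Z)) i j
·-assoc {N} X Y Z i j = begin
  ((X · Y) · Z) i j
    ≡⟨ sumFinℚ≡∑ (λ k → (X · Y) i k ℚ.* Z k j) ⟩
  ∑[ k < N ] ((X · Y) i k ℚ.* Z k j)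
    ≡⟨ ℚΣ.sum-cong-≗ (λ k → cong (ℚ._* Z k j) (sumFinℚ≡∑ (λ l → X i l ℚ.* Y l k))) ⟩
  ∑[ k < N ] (∑[ l < N ] (X i l ℚ.* Y l k) ℚ.* Z k j)
    ≡⟨ ℚΣ.sum-cong-≗ (λ k → ℚΣ.*-distribʳ-sum (Z k j) (λ l → X i l ℚ.* Y l k)) ⟩
  ∑[ k < N ] ∑[ l < N ] (X i l ℚ.* Y l k ℚ.* Z k j)
    ≡⟨ ℚΣ.∑-comm (λ k l → X i l ℚ.* Y l k ℚ.* Z k j) ⟩
  ∑[ l < N ] ∑[ k < N ] (X i l ℚ.* Y l k ℚ.* Z k j)
    ≡⟨ ℚΣ.sum-cong-≗ (λ l → ℚΣ.sum-cong-≗ (λ k → ℚ.*-assoc (X i l) (Y l k) (Z k j))) ⟩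
  ∑[ l < N ] ∑[ k < N ] (X i l ℚ.* (Y l k ℚ.* Z k j))
    ≡⟨ ℚΣ.sum-cong-≗ (λ l → ℚΣ.*-distribˡ-sum (X i l) (λ k → Y l k ℚ.* Z k j)) ⟨
  ∑[ l < N ] (X i l ℚ.* ∑[ k < N ] (Y l k ℚ.* Z k j))
    ≡⟨ ℚΣ.sum-cong-≗ (λ l → cong (X i l ℚ.*_) (sumFinℚ≡∑ (λ k → Y l k ℚ.* Z k j))) ⟨
  ∑[ l < N ] (X i l ℚ.* (Y · Z) l j)
    ≡⟨ sumFinℚ≡∑ (λ l → X i l ℚ.* (Y · Z) l j) ⟨
  (X · (Y · Z)) i j ∎
  where
  open ≡-Reasoning
  open ℚΣ using (sum-syntax)

inverse-unique : ∀ {N} (E C M : Matrix N) → (∀ i j → (E · C) i j ≡ idMatrix i j) →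
                 (∀ i j → (C · M) i j ≡ idMatrix i j) → ∀ i j → M i j ≡ E i j
inverse-unique E C M EC≡I CM≡I i j = begin
  M i j                                  ≡⟨ ∑ℚ-δˡ i (λ k → M k j) ⟨
  ℚΣ.sum (λ k → idMatrix i k ℚ.* M k j)  ≡⟨ sumFinℚ≡∑ (λ k → idMatrix i k ℚ.* M k j) ⟨
  (idMatrix · M) i j                     ≡⟨ sumFinℚ-cong (λ k → cong (ℚ._* M k j) (EC≡I i k)) ⟨
  ((E · C) · M) i j                      ≡⟨ ·-assoc E C M i j ⟩
  (E · (C · M)) i j                      ≡⟨ sumFinℚ-cong (λ k → cong (E i k ℚ.*_) (CM≡I k j)) ⟩
  (E · idMatrix) i j                     ≡⟨ sumFinℚ≡∑ (λ k → E i k ℚ.* idMatrix k j) ⟩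
  ℚΣ.sum (λ k → E i k ℚ.* idMatrix k j)  ≡⟨ ∑ℚ-δʳ j (E i) ⟩
  E i j                                  ∎
  where open ≡-Reasoning

-- Residues and Kupisch series

module _ {m : ℕ} where
  private
    n = suc m

  toℕ-mod : ∀ x → toℕ (x mod n) ≡ x % n
  toℕ-mod x = toℕ-fromℕ< (m%n<n x n)

  mod-cong : ∀ x y → x % n ≡ y % n → x mod n ≡ y mod n
  mod-cong x y eq = toℕ-injective (trans (toℕ-mod x) (trans eq (sym (toℕ-mod y))))

  mod-toℕ : ∀ (i : Fin n) → toℕ i mod n ≡ i
  mod-toℕ i = toℕ-injective (trans (toℕ-mod (toℕ i)) (m<n⇒m%n≡m (toℕ<n i)))

  residue-split : ∀ y → toℕ (y mod n) + (y / n) * n ≡ y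
  residue-split y = trans (cong (_+ (y / n) * n) (toℕ-mod y)) (sym (m≡m%n+[m/n]*n y n))

  same-residue : ∀ (i j : Fin n) P Q → toℕ i + P * n ≡ toℕ j + Q * n → i ≡ j
  same-residue i j P Q eq = toℕ-injective (begin
    toℕ i                    ≡⟨ m<n⇒m%n≡m (toℕ<n i) ⟨
    toℕ i % n                ≡⟨ [m+kn]%n≡m%n (toℕ i) P n ⟨
    (toℕ i + P * n) % n      ≡⟨ cong (_% n) eq ⟩
    (toℕ j + Q * n) % n      ≡⟨ [m+kn]%n≡m%n (toℕ j) Q n ⟩
    toℕ j % n                ≡⟨ m<n⇒m%n≡m (toℕ<n j) ⟩
    toℕ j                    ∎)
    where open ≡-Reasoning

  suc-% : ∀ x → suc (x % n) < n → suc x % n ≡ suc (x % n)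
  suc-% x r+1<n = begin
    suc x % n                          ≡⟨ cong (λ y → suc y % n) (m≡m%n+[m/n]*n x n) ⟩
    (suc (x % n) + (x / n) * n) % n    ≡⟨ [m+kn]%n≡m%n (suc (x % n)) (x / n) n ⟩
    suc (x % n) % n                    ≡⟨ m<n⇒m%n≡m r+1<n ⟩
    suc (x % n)                        ∎
    where open ≡-Reasoning

  residue-cases : ∀ x → x mod n ≡ fromℕ m
                      ⊎ ∃ λ (i : Fin m) → x mod n ≡ inject₁ i × suc x mod n ≡ fsuc i
  residue-cases x with x % n <? m
  ... | no r≮m = inj₁ (toℕ-injective (begin
    toℕ (x mod n)  ≡⟨ toℕ-mod x ⟩
    x % n          ≡⟨ ≤-antisym (≤-pred (m%n<n x n)) (≮⇒≥ r≮m) ⟩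
    m              ≡⟨ toℕ-fromℕ m ⟨
    toℕ (fromℕ m)  ∎))
    where open ≡-Reasoning
  ... | yes r<m = inj₂ (fromℕ< r<m , toℕ-injective lower , toℕ-injective upper)
    where
    lower : toℕ (x mod n) ≡ toℕ (inject₁ (fromℕ< r<m))
    lower = trans (toℕ-mod x) (sym (trans (toℕ-inject₁ _) (toℕ-fromℕ< r<m)))
    upper : toℕ (suc x mod n) ≡ suc (toℕ (fromℕ< r<m))
    upper = trans (toℕ-mod (suc x)) (trans (suc-% x (s≤s r<m)) (cong suc (sym (toℕ-fromℕ< r<m))))

Admissible : ∀ {m} → (Fin (suc m) → ℕ) → Set
Admissible c = (∀ x → 1 ≤ cK c x) × (∀ x → cK c x ∸ 1 ≤ cK c (suc x))

kupisch-admissible : ∀ {m} q (c : Fin (suc m) → ℕ) → IsKupischSeries m q c → Admissible c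
kupisch-admissible cyclic c (≥2 , step) = (λ x → ≤-trans (s≤s z≤n) (≥2 _)) , step
kupisch-admissible linear c (last , ≥2 , step) = positive , stepping
  where
  positive : ∀ x → 1 ≤ cK c x
  positive x with residue-cases x
  ... | inj₁ r≡m            = ≤-reflexive (sym (trans (cong c r≡m) last))
  ... | inj₂ (i , r≡i , _)  = ≤-trans (s≤s z≤n) (subst (λ r → 2 ≤ c r) (sym r≡i) (≥2 i))
  stepping : ∀ x → cK c x ∸ 1 ≤ cK c (suc x)
  stepping x with residue-cases x
  ... | inj₁ r≡m              = subst (λ v → v ∸ 1 ≤ cK c (suc x)) (sym (trans (cong c r≡m) last)) z≤n
  ... | inj₂ (i , r≡i , r+1≡) =
    subst₂ (λ u v → u ∸ 1 ≤ v) (cong c (sym r≡i)) (cong c (sym r+1≡)) (step i)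

module Kupisch {m : ℕ} (c : Fin (suc m) → ℕ) (admissible : Admissible c) where

  n : ℕ
  n = suc m

  f : ℕ → ℕ
  f x = x + cK c x

  cK-toℕ : ∀ (i : Fin n) → cK c (toℕ i) ≡ c i
  cK-toℕ i = cong c (mod-toℕ i)

  cK-shiftₖ : ∀ x k → cK c (x + k * n) ≡ cK c x
  cK-shiftₖ x k = cong c (mod-cong (x + k * n) x ([m+kn]%n≡m%n x k n))

  f-inflationary : ∀ x → x < f x
  f-inflationary x = m<m+n x (proj₁ admissible x)

  f-mono-suc : ∀ x → f x ≤ f (suc x)
  f-mono-suc x = begin
    x + cK c x                  ≤⟨ +-monoʳ-≤ x (m≤n+m∸n (cK c x) 1) ⟩
    x + (1 + (cK c x ∸ 1))      ≡⟨ +-suc x (cK c x ∸ 1) ⟩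
    suc x + (cK c x ∸ 1)        ≤⟨ +-monoʳ-≤ (suc x) (proj₂ admissible x) ⟩
    suc x + cK c (suc x)        ∎
    where open ≤-Reasoning

  f-mono : ∀ {x y} → x ≤ y → f x ≤ f y
  f-mono {x} {y} x≤y = subst (λ z → f x ≤ f z) (m+[n∸m]≡n x≤y) (steps (y ∸ x))
    where
    steps : ∀ d → f x ≤ f (x + d)
    steps zero    = ≤-reflexive (cong f (sym (+-identityʳ x)))
    steps (suc d) = ≤-trans (steps d) (subst (λ z → f (x + d) ≤ f z) (sym (+-suc x d)) (f-mono-suc (x + d)))

  f-shift : ∀ x → f (x + n) ≡ f x + n
  f-shift x = begin
    x + n + cK c (x + n)        ≡⟨ cong (λ k → x + n + cK c k) (cong (x +_) (sym (*-identityˡ n))) ⟩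
    x + n + cK c (x + 1 * n)    ≡⟨ cong (x + n +_) (cK-shiftₖ x 1) ⟩
    x + n + cK c x              ≡⟨ xy∙z≈xz∙y x n (cK c x) ⟩
    x + cK c x + n              ∎
    where open ≡-Reasoning

  open Orbits n f f-inflationary f-mono f-shift public

  -- Global dimension

  Ω^ : ℕ → ℕ × ℕ → ℕ × ℕ
  Ω^ = iterate (syzygy c)

  FinitePD : ℕ → ℕ → Set
  FinitePD a l = ∃ λ k → proj₂ (Ω^ k (a , l)) ≡ 0

  syzygy-fits : ∀ a l → cK c a ∸ suc l ≤ cK c (a + suc l)
  syzygy-fits a l = m≤n+o⇒m∸n≤o (cK c a) (suc l) (+-cancelˡ-≤ a _ _ (begin
    a + cK c a                       ≤⟨ f-mono (m≤m+n a (suc l)) ⟩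
    a + suc l + cK c (a + suc l)     ≡⟨ +-assoc a (suc l) _ ⟩
    a + (suc l + cK c (a + suc l))   ∎))
    where open ≤-Reasoning

  syzygy-end : ∀ a l → suc l ≤ cK c a → a + suc l + (cK c a ∸ suc l) ≡ f a
  syzygy-end a l l<c = trans (+-assoc a (suc l) _) (cong (a +_) (m+[n∸m]≡n l<c))

  finite-pd⇒meet : ∀ k {a l} → l ≤ cK c a → proj₂ (Ω^ k (a , l)) ≡ 0 → Meet a (a + l)
  finite-pd⇒meet zero    {a} {l}     _   refl = 0 , 0 , sym (+-identityʳ a)
  finite-pd⇒meet (suc k) {a} {zero}  _   _    = 0 , 0 , sym (+-identityʳ a)
  finite-pd⇒meet (suc k) {a} {suc l} l<c pd with finite-pd⇒meet k (syzygy-fits a l) pd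
  ... | p , q , e = suc q , p , (begin
    f^ q (f a)                               ≡⟨ cong (f^ q) (syzygy-end a l l<c) ⟨
    f^ q (a + suc l + (cK c a ∸ suc l))      ≡⟨ e ⟨
    f^ p (a + suc l)                         ∎)
    where open ≡-Reasoning

  meet⇒finite-pd : ∀ {a l} p q → Acc _<_ (p + q) → l ≤ cK c a → f^ p a ≡ f^ q (a + l) → FinitePD a l
  meet⇒finite-pd {a} {zero}  _       _ _        _   _ = 0 , refl
  meet⇒finite-pd {a} {suc l} zero    q _        _   e =
    ⊥-elim (<⇒≱ (m<m+n a (s≤s z≤n)) (≤-trans (f^-inflationary q (a + suc l)) (≤-reflexive (sym e))))
  meet⇒finite-pd {a} {suc l} (suc p) q (acc rs) l<c e
    with meet⇒finite-pd q p (rs (≤-reflexive (cong suc (+-comm q p)))) (syzygy-fits a l)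
           (trans (sym e) (cong (f^ p) (sym (syzygy-end a l l<c))))
  ... | k , pd = suc k , pd

  syzygy-zero-stable : ∀ s {k l} → k ≤ l → proj₂ (Ω^ k s) ≡ 0 → proj₂ (Ω^ l s) ≡ 0
  syzygy-zero-stable s {k} {l} k≤l pd = subst (λ t → proj₂ (Ω^ t s) ≡ 0) (m+[n∸m]≡n k≤l)
    (trans (cong proj₂ (iterate-+ (syzygy c) k (l ∸ k) s)) (zero-stays (l ∸ k) pd))
    where
    zero-stays : ∀ t {s} → proj₂ s ≡ 0 → proj₂ (Ω^ t s) ≡ 0
    zero-stays zero    eq             = eq
    zero-stays (suc t) {j , zero} _   = zero-stays t refl

  ConsecutiveMeets : Set
  ConsecutiveMeets = ∀ (i : Fin n) → Meet (toℕ i) (suc (toℕ i))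

  FGD⇒meets : FiniteGlobalDimension c → ConsecutiveMeets
  FGD⇒meets (d , pd) i =
    subst (Meet (toℕ i)) (+-comm (toℕ i) 1) (finite-pd⇒meet d (proj₁ admissible (toℕ i)) (pd i))

  meets⇒FGD : ConsecutiveMeets → FiniteGlobalDimension c
  meets⇒FGD meets = common-bound (λ i d → proj₂ (Ω^ d (toℕ i , 1)) ≡ 0)
    (λ i → syzygy-zero-stable (toℕ i , 1))
    (λ i → let p , q , e = meets i in
      meet⇒finite-pd p q (<-wellFounded (p + q)) (proj₁ admissible (toℕ i))
        (trans e (cong (f^ q) (+-comm 1 (toℕ i)))))

  -- The inverse of the Cartan matrix

  δ-mod : ℕ → Fin n → ℕ
  δ-mod y = δ (y mod n)

  δ-mod-% : ∀ x y k → x % n ≡ y % n → δ-mod x k ≡ δ-mod y k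
  δ-mod-% x y k eq = cong (λ r → δ r k) (mod-cong x y eq)

  δ-mod-toℕ : ∀ (i : Fin n) k → δ-mod (toℕ i) k ≡ δ i k
  δ-mod-toℕ i k = cong (λ r → δ r k) (mod-toℕ i)

  orbitCount : ℕ → ℕ → Fin n → ℕ
  orbitCount N y k = sumℕ N (λ s → δ-mod (f^ s y) k)

  intervalCount : ℕ → ℕ → Fin n → ℕ
  intervalCount u L k = sumℕ L (λ t → δ-mod (u + t) k)

  cartan-interval : ∀ y k → cartanℕ c (y mod n) k ≡ intervalCount y (cK c y) k
  cartan-interval y k = sumℕ-cong (cK c y) (λ t → δ-mod-% (toℕ (y mod n) + t) (y + t) k (begin
    (toℕ (y mod n) + t) % n          ≡⟨ cong (λ r → (r + t) % n) (toℕ-mod y) ⟩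
    (y % n + t) % n                  ≡⟨ %-distribˡ-+ (y % n) t n ⟩
    (y % n % n + t % n) % n          ≡⟨ cong (λ r → (r + t % n) % n) (m%n%n≡m%n y n) ⟩
    (y % n + t % n) % n              ≡⟨ %-distribˡ-+ y t n ⟨
    (y + t) % n                      ∎))
    where open ≡-Reasoning

  intervalCount-+ : ∀ u a b k → intervalCount u (a + b) k ≡ intervalCount u a k + intervalCount (u + a) b k
  intervalCount-+ u a b k = trans (sumℕ-+ a b (λ t → δ-mod (u + t) k))
    (cong (intervalCount u a k +_) (sumℕ-cong b (λ t → cong (λ z → δ-mod z k) (sym (+-assoc u a t)))))

  intervalCount-tiling : ∀ N y L k → y + L ≡ f^ N y →
    sumℕ N (λ s → intervalCount (f^ s y) (cK c (f^ s y)) k) ≡ intervalCount y L k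
  intervalCount-tiling zero    y L k y+L≡y with +-cancelˡ-≡ y L 0 (trans y+L≡y (sym (+-identityʳ y)))
  ... | refl = refl
  intervalCount-tiling (suc N) y L k y+L≡ = begin
    intervalCount y (cK c y) k + sumℕ N (λ s → intervalCount (f^ s (f y)) (cK c (f^ s (f y))) k)
      ≡⟨ cong (intervalCount y (cK c y) k +_) (intervalCount-tiling N (f y) (L ∸ cK c y) k fy+L′≡) ⟩
    intervalCount y (cK c y) k + intervalCount (f y) (L ∸ cK c y) k
      ≡⟨ intervalCount-+ y (cK c y) (L ∸ cK c y) k ⟨
    intervalCount y (cK c y + (L ∸ cK c y)) k
      ≡⟨ cong (λ l → intervalCount y l k) (m+[n∸m]≡n c≤L) ⟩
    intervalCount y L k ∎
    where
    open ≡-Reasoning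
    c≤L : cK c y ≤ L
    c≤L = +-cancelˡ-≤ y _ _ (≤-trans (f^-inflationary N (f y)) (≤-reflexive (sym y+L≡)))
    fy+L′≡ : f y + (L ∸ cK c y) ≡ f^ N (f y)
    fy+L′≡ = trans (+-assoc y (cK c y) _) (trans (cong (y +_) (m+[n∸m]≡n c≤L)) y+L≡)

  intervalCount-suc : ∀ u L k → intervalCount u (suc L) k ≡ δ-mod u k + intervalCount (suc u) L k
  intervalCount-suc u L k = cong₂ _+_ (cong (λ z → δ-mod z k) (+-identityʳ u))
    (sumℕ-cong L (λ t → cong (λ z → δ-mod z k) (+-suc u t)))

  ∑-count-weighted : ∀ L (h : ℕ → ℕ) (g : Fin n → ℕ) →
    sumFinℕ (λ k → sumℕ L (λ t → δ-mod (h t) k) * g k) ≡ sumℕ L (λ t → g (h t mod n))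
  ∑-count-weighted zero    h g = sumFinℕ-zero n
  ∑-count-weighted (suc L) h g = begin
    sumFinℕ (λ k → (δ-mod (h 0) k + sumℕ L (λ t → δ-mod (h (suc t)) k)) * g k)
      ≡⟨ sumFinℕ-cong (λ k → *-distribʳ-+ (g k) (δ-mod (h 0) k) (sumℕ L (λ t → δ-mod (h (suc t)) k))) ⟩
    sumFinℕ (λ k → δ-mod (h 0) k * g k + sumℕ L (λ t → δ-mod (h (suc t)) k) * g k)
      ≡⟨ sumFinℕ-+ (λ k → δ-mod (h 0) k * g k) (λ k → sumℕ L (λ t → δ-mod (h (suc t)) k) * g k) ⟩
    sumFinℕ (λ k → δ-mod (h 0) k * g k) + sumFinℕ (λ k → sumℕ L (λ t → δ-mod (h (suc t)) k) * g k)
      ≡⟨ cong₂ _+_ (∑-δˡ (h 0 mod n) g) (∑-count-weighted L (h ∘ suc) g) ⟩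
    g (h 0 mod n) + sumℕ L (λ t → g (h (suc t) mod n)) ∎
    where open ≡-Reasoning

  orbitCount-cartan : ∀ N y L j → y + L ≡ f^ N y →
    sumFinℕ (λ k → orbitCount N y k * cartanℕ c k j) ≡ intervalCount y L j
  orbitCount-cartan N y L j y+L≡ = begin
    sumFinℕ (λ k → orbitCount N y k * cartanℕ c k j)
      ≡⟨ ∑-count-weighted N (λ s → f^ s y) (λ k → cartanℕ c k j) ⟩
    sumℕ N (λ s → cartanℕ c (f^ s y mod n) j)
      ≡⟨ sumℕ-cong N (λ s → cartan-interval (f^ s y) j) ⟩
    sumℕ N (λ s → intervalCount (f^ s y) (cK c (f^ s y)) j)
      ≡⟨ intervalCount-tiling N y L j y+L≡ ⟩
    intervalCount y L j ∎
    where open ≡-Reasoning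

  orbitCount-+ : ∀ u v x k → orbitCount (u + v) x k ≡ orbitCount u x k + orbitCount v (f^ u x) k
  orbitCount-+ u v x k = trans (sumℕ-+ u v (λ s → δ-mod (f^ s x) k))
    (cong (orbitCount u x k +_) (sumℕ-cong v (λ t → cong (λ z → δ-mod z k) (iterate-+ f u t x))))

  orbitCount-shift : ∀ N x K k → orbitCount N (x + K * n) k ≡ orbitCount N x k
  orbitCount-shift N x K k = sumℕ-cong N (λ s → trans (cong (λ z → δ-mod z k) (f^-shift s x K))
    (δ-mod-% (f^ s x + K * n) (f^ s x) k ([m+kn]%n≡m%n (f^ s x) K n)))

  ∑-δ-mod : ∀ y → sumFinℕ (δ-mod y) ≡ 1
  ∑-δ-mod y = trans (sumFinℕ-cong (λ k → sym (*-identityʳ (δ-mod y k)))) (∑-δˡ (y mod n) (λ _ → 1))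

  ∑-orbitCount : ∀ N y → sumFinℕ (orbitCount N y) ≡ N
  ∑-orbitCount zero    y = sumFinℕ-zero n
  ∑-orbitCount (suc N) y = begin
    sumFinℕ (λ k → δ-mod y k + orbitCount N (f y) k)   ≡⟨ sumFinℕ-+ (δ-mod y) (orbitCount N (f y)) ⟩
    sumFinℕ (δ-mod y) + sumFinℕ (orbitCount N (f y))   ≡⟨ cong₂ _+_ (∑-δ-mod y) (∑-orbitCount N (f y)) ⟩
    suc N                                              ∎
    where open ≡-Reasoning

  private
    rearrange : ∀ α β γ ρ X Y κ ζ → X + (κ + ρ) ≡ Y + (ζ + β) → α + β ≡ γ + ρ →
                α + X + κ ≡ ζ + Y + γ
    rearrange α β γ ρ X Y κ ζ ih swap = +-cancelʳ-≡ ρ _ _ (begin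
      α + X + κ + ρ          ≡⟨ solve (α ∷ X ∷ κ ∷ ρ ∷ []) ⟩
      α + (X + (κ + ρ))      ≡⟨ cong (α +_) ih ⟩
      α + (Y + (ζ + β))      ≡⟨ solve (α ∷ Y ∷ ζ ∷ β ∷ []) ⟩
      (α + β) + (ζ + Y)      ≡⟨ cong (_+ (ζ + Y)) swap ⟩
      (γ + ρ) + (ζ + Y)      ≡⟨ solve (γ ∷ ρ ∷ ζ ∷ Y ∷ []) ⟩
      ζ + Y + γ + ρ          ∎)
      where open ≡-Reasoning

  -- The signed orbit count of a chain of meets equals that of any single meet of its ends.
  orbitCount-chain : ∀ L (u p q : ℕ → ℕ) → (∀ t → f^ (p t) (u t) ≡ f^ (q t) (u (suc t))) →
    ∀ P Q → f^ P (u 0) ≡ f^ Q (u L) → ∀ j →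
    sumℕ L (λ t → orbitCount (p t) (u t) j) + orbitCount Q (u L) j ≡
    sumℕ L (λ t → orbitCount (q t) (u (suc t)) j) + orbitCount P (u 0) j
  orbitCount-chain zero    u p q meets P Q e j =
    cong (λ s → orbitCount s (u 0) j) (sym (f^-injectiveˡ (u 0) {P} {Q} e))
  orbitCount-chain (suc L) u p q meets P Q e j =
    rearrange (Φ p₀ (u 0)) (Φ P (f^ q₀ (u 1))) (Φ P (u 0)) (Φ p₀ (f^ Q end)) X Y (Φ Q end) (Φ q₀ (u 1))
      tail exponents-commute
    where
    Φ : ℕ → ℕ → ℕ
    Φ N y = orbitCount N y j
    p₀ = p 0
    q₀ = q 0
    end = u (suc L)
    X = sumℕ L (λ t → Φ (p (suc t)) (u (suc t)))
    Y = sumℕ L (λ t → Φ (q (suc t)) (u (suc (suc t))))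
    tail-meet : Meet (u 1) end
    tail-meet = Meet-trans (Meet-sym (p₀ , q₀ , meets 0)) (P , Q , e)
    tail : X + (Φ Q end + Φ p₀ (f^ Q end)) ≡ Y + (Φ q₀ (u 1) + Φ P (f^ q₀ (u 1)))
    tail = begin
      X + (Φ Q end + Φ p₀ (f^ Q end))     ≡⟨ cong (X +_) (orbitCount-+ Q p₀ end j) ⟨
      X + Φ (Q + p₀) end                  ≡⟨ cong (λ s → X + Φ s end) (+-comm Q p₀) ⟩
      X + Φ (p₀ + Q) end                  ≡⟨ orbitCount-chain L (u ∘ suc) (p ∘ suc) (q ∘ suc) (meets ∘ suc)
                                               (q₀ + P) (p₀ + Q) (proj₂ (proj₂ tail-meet)) j ⟩
      Y + Φ (q₀ + P) (u 1)                ≡⟨ cong (Y +_) (orbitCount-+ q₀ P (u 1) j) ⟩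
      Y + (Φ q₀ (u 1) + Φ P (f^ q₀ (u 1))) ∎
      where open ≡-Reasoning
    exponents-commute : Φ p₀ (u 0) + Φ P (f^ q₀ (u 1)) ≡ Φ P (u 0) + Φ p₀ (f^ Q end)
    exponents-commute = begin
      Φ p₀ (u 0) + Φ P (f^ q₀ (u 1))      ≡⟨ cong (λ z → Φ p₀ (u 0) + Φ P z) (meets 0) ⟨
      Φ p₀ (u 0) + Φ P (f^ p₀ (u 0))      ≡⟨ orbitCount-+ p₀ P (u 0) j ⟨
      Φ (p₀ + P) (u 0)                    ≡⟨ cong (λ s → Φ s (u 0)) (+-comm p₀ P) ⟩
      Φ (P + p₀) (u 0)                    ≡⟨ orbitCount-+ P p₀ (u 0) j ⟩
      Φ P (u 0) + Φ p₀ (f^ P (u 0))       ≡⟨ cong (λ z → Φ P (u 0) + Φ p₀ z) e ⟩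
      Φ P (u 0) + Φ p₀ (f^ Q end)         ∎
      where open ≡-Reasoning

  full-fixed : ∀ {i} → c i ≡ n → f (toℕ i) ≡ toℕ i + n
  full-fixed {i} full = cong (toℕ i +_) (trans (cK-toℕ i) full)

  full-residue : ∀ {y} → f y ≡ y + n → c (y mod n) ≡ n
  full-residue {y} fy = +-cancelˡ-≡ y _ _ fy

  module WithMeets (meets : ConsecutiveMeets) where

    p q : Fin n → ℕ
    p i = proj₁ (meets i)
    q i = proj₁ (proj₂ (meets i))

    pℕ qℕ : ℕ → ℕ
    pℕ y = p (y mod n)
    qℕ y = q (y mod n)

    meet-at : ∀ y → f^ (pℕ y) y ≡ f^ (qℕ y) (suc y)
    meet-at y = begin
      f^ (pℕ y) y                 ≡⟨ cong (f^ (pℕ y)) (residue-split y) ⟨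
      f^ (pℕ y) (r + K * n)       ≡⟨ f^-shift (pℕ y) r K ⟩
      f^ (pℕ y) r + K * n         ≡⟨ cong (_+ K * n) (proj₂ (proj₂ (meets (y mod n)))) ⟩
      f^ (qℕ y) (suc r) + K * n   ≡⟨ f^-shift (qℕ y) (suc r) K ⟨
      f^ (qℕ y) (suc r + K * n)   ≡⟨ cong (f^ (qℕ y) ∘ suc) (residue-split y) ⟩
      f^ (qℕ y) (suc y)           ∎
      where
      open ≡-Reasoning
      r = toℕ (y mod n)
      K = y / n

    zero-meets : ∀ L → Meet 0 L
    zero-meets L = sumℕ L pℕ , sumℕ L qℕ , meet-chain L (λ t → t) pℕ qℕ meet-at

    all-meet : ∀ a b → Meet a b
    all-meet a b = Meet-trans (Meet-sym (zero-meets a)) (zero-meets b)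

    at-most-one-full : ∀ i j → c i ≡ n → c j ≡ n → i ≡ j
    at-most-one-full i j ci cj with all-meet (toℕ i) (toℕ j)
    ... | P , Q , e = same-residue i j P Q (begin
      toℕ i + P * n       ≡⟨ f^-fixed (full-fixed ci) P ⟨
      f^ P (toℕ i)        ≡⟨ e ⟩
      f^ Q (toℕ j)        ≡⟨ f^-fixed (full-fixed cj) Q ⟩
      toℕ j + Q * n       ∎)
      where open ≡-Reasoning

    unique-full : ∃ (λ i → c i ≡ n) → ∃! _≡_ (λ i → c i ≡ n)
    unique-full (i , ci) = i , ci , λ cj → at-most-one-full i _ ci cj

    Σp Σq : ℕ
    Σp = sumℕ n pℕ
    Σq = sumℕ n qℕ

    w : ℕ
    w = f^ Σq 0

    turn : f^ Σp 0 ≡ w + n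
    turn = trans (proj₂ (proj₂ (zero-meets n))) (f^-shift₁ Σq 0)

    Σq<Σp : Σq < Σp
    Σq<Σp with Σp ≤? Σq
    ... | yes Σp≤Σq = ⊥-elim (<⇒≱ (m<m+n w (s≤s z≤n)) (subst (_≤ w) turn (f^-monoˡ 0 Σp≤Σq)))
    ... | no Σp≰Σq = ≰⇒> Σp≰Σq

    cycle : f^ (Σp ∸ Σq) w ≡ w + n
    cycle = begin
      f^ (Σp ∸ Σq) (f^ Σq 0)     ≡⟨ iterate-+ f Σq (Σp ∸ Σq) 0 ⟨
      f^ (Σq + (Σp ∸ Σq)) 0      ≡⟨ cong (λ s → f^ s 0) (m+[n∸m]≡n (<⇒≤ Σq<Σp)) ⟩
      f^ Σp 0                    ≡⟨ turn ⟩
      w + n                      ∎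
      where open ≡-Reasoning

    unit-period⇒full : Σp ≡ suc Σq → ∃ λ i → c i ≡ n
    unit-period⇒full Σp≡ = w mod n , full-residue (subst (λ s → f^ s w ≡ w + n) period≡1 cycle)
      where
      period≡1 : Σp ∸ Σq ≡ 1
      period≡1 = trans (cong (_∸ Σq) Σp≡) (m+n∸n≡m 1 Σq)

    long-loewy⇒full : ∀ y → n ≤ c y → ∃ λ i → c i ≡ n
    long-loewy⇒full y n≤cy with Σp ∸ Σq | cycle | m>n⇒m∸n≢0 Σq<Σp
    ... | zero        | _   | period≢0 = ⊥-elim (period≢0 refl)
    ... | suc zero    | cyc | _ = w mod n , full-residue cyc
    ... | suc (suc d) | cyc | _ = y , ≤-antisym cy≤n n≤cy
      where
      y′ = toℕ y + w * n
      cy≤n : c y ≤ n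
      cy≤n = subst (_≤ n) (trans (cK-shiftₖ (toℕ y) w) (cK-toℕ y))
        (+-cancelˡ-≤ y′ _ _ (long-period⇒short-steps d cyc (≤-trans (m≤m*n w n) (m≤n+m (w * n) (toℕ y)))))

    A B : Fin n → Fin n → ℕ
    A x k = orbitCount (p x) (toℕ x) k
    B x k = orbitCount (q x) (suc (toℕ x)) k

    A·C : ∀ x j → sumFinℕ (λ k → A x k * cartanℕ c k j) ≡ sumFinℕ (λ k → B x k * cartanℕ c k j) + δ x j
    A·C x j = begin
      sumFinℕ (λ k → A x k * cartanℕ c k j)
        ≡⟨ orbitCount-cartan (p x) a (suc L) j (trans (+-suc a L) (trans a+1+L≡W (sym meet))) ⟩
      intervalCount a (suc L) j
        ≡⟨ intervalCount-suc a L j ⟩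
      δ-mod a j + intervalCount (suc a) L j
        ≡⟨ +-comm (δ-mod a j) _ ⟩
      intervalCount (suc a) L j + δ-mod a j
        ≡⟨ cong₂ _+_ (sym (orbitCount-cartan (q x) (suc a) L j a+1+L≡W)) (δ-mod-toℕ x j) ⟩
      sumFinℕ (λ k → B x k * cartanℕ c k j) + δ x j ∎
      where
      open ≡-Reasoning
      a = toℕ x
      meet : f^ (p x) a ≡ f^ (q x) (suc a)
      meet = proj₂ (proj₂ (meets x))
      W = f^ (q x) (suc a)
      L = W ∸ suc a
      a+1+L≡W : suc a + L ≡ W
      a+1+L≡W = m+[n∸m]≡n (f^-inflationary (q x) (suc a))

    A-periodic : ∀ y j → A (y mod n) j ≡ orbitCount (pℕ y) y j
    A-periodic y j = trans (sym (orbitCount-shift (pℕ y) (toℕ (y mod n)) (y / n) j))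
      (cong (λ z → orbitCount (pℕ y) z j) (residue-split y))

    B-periodic : ∀ y j → B (y mod n) j ≡ orbitCount (qℕ y) (suc y) j
    B-periodic y j = trans (sym (orbitCount-shift (qℕ y) (suc (toℕ (y mod n))) (y / n) j))
      (cong (λ z → orbitCount (qℕ y) (suc z) j) (residue-split y))

    C·A : ∀ i j → sumFinℕ (λ k → cartanℕ c i k * A k j) ≡ sumFinℕ (λ k → cartanℕ c i k * B k j) + δ i j
    C·A i j = begin
      sumFinℕ (λ k → cartanℕ c i k * A k j)     ≡⟨ row-A ⟩
      SA                                        ≡⟨ +-identityʳ SA ⟨
      SA + orbitCount 0 (a + L) j
        ≡⟨ orbitCount-chain L (a +_) (pℕ ∘ (a +_)) (qℕ ∘ (a +_)) consecutive 1 0 start j ⟩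
      SB′ + orbitCount 1 (a + 0) j
        ≡⟨ cong₂ _+_ (sumℕ-cong L (λ t → cong (λ z → orbitCount (qℕ (a + t)) z j) (+-suc a t))) first-step ⟩
      SB + δ i j                                ≡⟨ cong (_+ δ i j) row-B ⟨
      sumFinℕ (λ k → cartanℕ c i k * B k j) + δ i j ∎
      where
      open ≡-Reasoning
      a = toℕ i
      L = c i
      SA = sumℕ L (λ t → orbitCount (pℕ (a + t)) (a + t) j)
      SB′ = sumℕ L (λ t → orbitCount (qℕ (a + t)) (a + suc t) j)
      SB = sumℕ L (λ t → orbitCount (qℕ (a + t)) (suc (a + t)) j)
      row-A : sumFinℕ (λ k → cartanℕ c i k * A k j) ≡ SA
      row-A = trans (∑-count-weighted L (a +_) (λ k → A k j)) (sumℕ-cong L (λ t → A-periodic (a + t) j))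
      row-B : sumFinℕ (λ k → cartanℕ c i k * B k j) ≡ SB
      row-B = trans (∑-count-weighted L (a +_) (λ k → B k j)) (sumℕ-cong L (λ t → B-periodic (a + t) j))
      consecutive : ∀ t → f^ (pℕ (a + t)) (a + t) ≡ f^ (qℕ (a + t)) (a + suc t)
      consecutive t = trans (meet-at (a + t)) (cong (f^ (qℕ (a + t))) (sym (+-suc a t)))
      start : f (a + 0) ≡ a + L
      start = trans (cong f (+-identityʳ a)) (cong (a +_) (cK-toℕ i))
      first-step : orbitCount 1 (a + 0) j ≡ δ i j
      first-step = trans (+-identityʳ _) (trans (cong (λ z → δ-mod z j) (+-identityʳ a)) (δ-mod-toℕ i j))

    ∑-A : ∀ x → sumFinℕ (A x) ≡ p x
    ∑-A x = ∑-orbitCount (p x) (toℕ x)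

    ∑-B : ∀ x → sumFinℕ (B x) ≡ q x
    ∑-B x = ∑-orbitCount (q x) (suc (toℕ x))

    ∑-p : sumFinℕ p ≡ Σp
    ∑-p = trans (sumFinℕ-cong (λ x → cong p (sym (mod-toℕ x)))) (sumFinℕ-toℕ n pℕ)

    ∑-q : sumFinℕ q ≡ Σq
    ∑-q = trans (sumFinℕ-cong (λ x → cong q (sym (mod-toℕ x)))) (sumFinℕ-toℕ n qℕ)

    E : Matrix n
    E x k = ⟦ A x k ⟧ ℚ.- ⟦ B x k ⟧

    E-inverseˡ : ∀ x j → (E · cartan c) x j ≡ idMatrix x j
    E-inverseˡ x j = begin
      sumFinℚ (λ k → E x k ℚ.* cartan c k j)
        ≡⟨ sumFinℚ-cong (λ k → ⟦⟧-difference-*ʳ (A x k) (B x k) (cartanℕ c k j)) ⟩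
      sumFinℚ (λ k → ⟦ A x k * cartanℕ c k j ⟧ ℚ.- ⟦ B x k * cartanℕ c k j ⟧)
        ≡⟨ sumFinℚ-⟦⟧-cancel (λ k → A x k * cartanℕ c k j) (λ k → B x k * cartanℕ c k j) (δ x j) (A·C x j) ⟩
      ⟦ δ x j ⟧  ≡⟨ ⟦⟧-δ x j ⟩
      idMatrix x j ∎
      where open ≡-Reasoning

    E-inverseʳ : ∀ i j → (cartan c · E) i j ≡ idMatrix i j
    E-inverseʳ i j = begin
      sumFinℚ (λ k → cartan c i k ℚ.* E k j)
        ≡⟨ sumFinℚ-cong (λ k → ⟦⟧-difference-*ˡ (cartanℕ c i k) (A k j) (B k j)) ⟩
      sumFinℚ (λ k → ⟦ cartanℕ c i k * A k j ⟧ ℚ.- ⟦ cartanℕ c i k * B k j ⟧)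
        ≡⟨ sumFinℚ-⟦⟧-cancel (λ k → cartanℕ c i k * A k j) (λ k → cartanℕ c i k * B k j) (δ i j) (C·A i j) ⟩
      ⟦ δ i j ⟧  ≡⟨ ⟦⟧-δ i j ⟩
      idMatrix i j ∎
      where open ≡-Reasoning

    sumEntries-E : sumEntries E ≡ ⟦ Σp ⟧ ℚ.- ⟦ Σq ⟧
    sumEntries-E = begin
      sumFinℚ (λ x → sumFinℚ (λ k → ⟦ A x k ⟧ ℚ.- ⟦ B x k ⟧))
        ≡⟨ sumFinℚ-cong (λ x → sumFinℚ-⟦⟧-difference (A x) (B x)) ⟩
      sumFinℚ (λ x → ⟦ sumFinℕ (A x) ⟧ ℚ.- ⟦ sumFinℕ (B x) ⟧)
        ≡⟨ sumFinℚ-cong (λ x → cong₂ (λ u v → ⟦ u ⟧ ℚ.- ⟦ v ⟧) (∑-A x) (∑-B x)) ⟩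
      sumFinℚ (λ x → ⟦ p x ⟧ ℚ.- ⟦ q x ⟧)
        ≡⟨ sumFinℚ-⟦⟧-difference p q ⟩
      ⟦ sumFinℕ p ⟧ ℚ.- ⟦ sumFinℕ q ⟧
        ≡⟨ cong₂ (λ u v → ⟦ u ⟧ ℚ.- ⟦ v ⟧) ∑-p ∑-q ⟩
      ⟦ Σp ⟧ ℚ.- ⟦ Σq ⟧ ∎
      where open ≡-Reasoning

    magnitude-one⇒unit-period : MagnitudeOne c → Σp ≡ suc Σq
    magnitude-one⇒unit-period (M , (C·M≡I , _) , sumM≡1) = ⟦m⟧-⟦n⟧≡1⇒m≡1+n (begin
      ⟦ Σp ⟧ ℚ.- ⟦ Σq ⟧   ≡⟨ sumEntries-E ⟨
      sumEntries E        ≡⟨ sumFinℚ-cong (λ i → sumFinℚ-cong (λ j → inverse-unique E (cartan c) M E-inverseˡ C·M≡I i j)) ⟨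
      sumEntries M        ≡⟨ sumM≡1 ⟩
      1ℚ                  ∎)
      where open ≡-Reasoning

    unit-period⇒magnitude-one : Σp ≡ suc Σq → MagnitudeOne c
    unit-period⇒magnitude-one Σp≡ = E , (E-inverseʳ , E-inverseˡ) ,
      trans sumEntries-E (trans (cong (λ a → ⟦ a ⟧ ℚ.- ⟦ Σq ⟧) Σp≡) (⟦1+n⟧-⟦n⟧≡1 Σq))

    period≡1⇒unit-period : Σp ∸ Σq ≡ 1 → Σp ≡ suc Σq
    period≡1⇒unit-period period≡1 = begin
      Σp                 ≡⟨ m+[n∸m]≡n (<⇒≤ Σq<Σp) ⟨
      Σq + (Σp ∸ Σq)     ≡⟨ cong (Σq +_) period≡1 ⟩
      Σq + 1             ≡⟨ +-comm Σq 1 ⟩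
      suc Σq             ∎
      where open ≡-Reasoning

  -- A unique full residue

  module UniqueFullResidue (i₀ : Fin n) (full : c i₀ ≡ n) (unique : ∀ i → c i ≡ n → i ≡ i₀) where

    b : ℕ
    b = toℕ i₀

    -- Truncation is harmless: T is only iterated above b, where f y ≥ b + n.
    T : ℕ → ℕ
    T y = f y ∸ n

    T-mono : ∀ {x y} → x ≤ y → T x ≤ T y
    T-mono x≤y = ∸-monoˡ-≤ n (f-mono x≤y)

    f-orbit : ∀ K → f (b + K * n) ≡ b + K * n + n
    f-orbit K = begin
      f (b + K * n)       ≡⟨ f-shiftₖ b K ⟩
      f b + K * n         ≡⟨ cong (_+ K * n) (full-fixed full) ⟩
      b + n + K * n       ≡⟨ xy∙z≈xz∙y b n (K * n) ⟩
      b + K * n + n       ∎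
      where open ≡-Reasoning

    T-orbit : ∀ K → T (b + K * n) ≡ b + K * n
    T-orbit K = trans (cong (_∸ n) (f-orbit K)) (m+n∸n≡m (b + K * n) n)

    T-b : T b ≡ b
    T-b = trans (cong T (sym (+-identityʳ b))) (trans (T-orbit 0) (+-identityʳ b))

    f≡T+n : ∀ {y} → b ≤ y → f y ≡ T y + n
    f≡T+n {y} b≤y = sym (m∸n+n≡m (≤-trans (m≤n+m n b) (subst (_≤ f y) (full-fixed full) (f-mono b≤y))))

    b≤T : ∀ {y} → b ≤ y → b ≤ T y
    b≤T {y} b≤y = subst (_≤ T y) T-b (T-mono b≤y)

    f^≡T^ : ∀ s {y} → b ≤ y → f^ s y ≡ iterate T s y + s * n
    f^≡T^ zero    {y} _   = sym (+-identityʳ y)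
    f^≡T^ (suc s) {y} b≤y = begin
      f^ s (f y)                       ≡⟨ cong (f^ s) (f≡T+n b≤y) ⟩
      f^ s (T y + n)                   ≡⟨ f^-shift₁ s (T y) ⟩
      f^ s (T y) + n                   ≡⟨ cong (_+ n) (f^≡T^ s (b≤T b≤y)) ⟩
      iterate T s (T y) + s * n + n    ≡⟨ xy∙z≈x∙zy (iterate T s (T y)) (s * n) n ⟩
      iterate T s (T y) + suc s * n    ∎
      where open ≡-Reasoning

    T-fixed⇒orbit : ∀ {x} → b ≤ x → T x ≡ x → x ≡ b + (x / n) * n
    T-fixed⇒orbit {x} b≤x Tx≡x = begin
      x                        ≡⟨ m≡m%n+[m/n]*n x n ⟩
      x % n + (x / n) * n      ≡⟨ cong (_+ (x / n) * n) residue≡b ⟩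
      b + (x / n) * n          ∎
      where
      open ≡-Reasoning
      fx≡x+n : f x ≡ x + n
      fx≡x+n = trans (f≡T+n b≤x) (cong (_+ n) Tx≡x)
      residue≡b : x % n ≡ b
      residue≡b = trans (sym (toℕ-mod x)) (cong toℕ (unique (x mod n) (+-cancelˡ-≡ x _ _ fx≡x+n)))

    reach : ∀ y → b ≤ y → Meet y b
    reach y b≤y = s , x / n + s , (begin
      f^ s y                   ≡⟨ f^≡T^ s b≤y ⟩
      x + s * n                ≡⟨ cong (_+ s * n) (T-fixed⇒orbit b≤x fixed) ⟩
      b + (x / n) * n + s * n  ≡⟨ trans (+-assoc b _ _) (cong (b +_) (sym (*-distribʳ-+ n (x / n) s))) ⟩
      b + (x / n + s) * n      ≡⟨ f^-fixed (full-fixed full) (x / n + s) ⟨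
      f^ (x / n + s) b         ∎)
      where
      open ≡-Reasoning
      y≤top : y ≤ b + y * n
      y≤top = ≤-trans (m≤m*n y n) (m≤n+m (y * n) b)
      found = MonotoneFixedPoint.reach-fixed-point T T-mono T-b (T-orbit y) b≤y y≤top
      s = proj₁ found
      x = iterate T s y
      fixed = proj₁ (proj₂ found)
      b≤x = proj₂ (proj₂ found)

    b≤+n : ∀ y → b ≤ y + n
    b≤+n y = ≤-trans (<⇒≤ (toℕ<n i₀)) (m≤n+m n y)

    meets : ConsecutiveMeets
    meets i = Meet-unshift (Meet-trans (reach (a + n) (b≤+n a)) (Meet-sym (reach (suc a + n) (b≤+n (suc a)))))
      where a = toℕ i

    period-one : ∀ {d w} → f^ d w ≡ w + n → d ≡ 1
    period-one {d} {w} cyc = +-cancelˡ-≡ k d 1 (trans (f^-injectiveˡ b {k + d} {suc k} chain) (+-comm 1 k))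
      where
      open ≡-Reasoning
      hit = reach (w + n) (b≤+n w)
      s = proj₁ hit
      k = proj₁ (proj₂ hit)
      e = proj₂ (proj₂ hit)
      chain : f^ (k + d) b ≡ f^ (suc k) b
      chain = begin
        f^ (k + d) b             ≡⟨ iterate-+ f k d b ⟩
        f^ d (f^ k b)            ≡⟨ cong (f^ d) e ⟨
        f^ d (f^ s (w + n))      ≡⟨ iterate-comm f d s (w + n) ⟩
        f^ s (f^ d (w + n))      ≡⟨ cong (f^ s) (trans (f^-shift₁ d w) (cong (_+ n) cyc)) ⟩
        f^ s (w + n + n)         ≡⟨ f^-shift₁ s (w + n) ⟩
        f^ s (w + n) + n         ≡⟨ cong (_+ n) e ⟩
        f^ k b + n               ≡⟨ f^-shift₁ k b ⟨
        f^ k (b + n)             ≡⟨ cong (f^ k) (full-fixed full) ⟨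
        f^ (suc k) b             ∎

proposition4p4 : (m : ℕ) (q : QuiverType) (c : Fin (suc m) → ℕ)
    → IsKupischSeries m q c
    → ((FiniteGlobalDimension c × MagnitudeOne c) ⇔ ∃! _≡_ (λ i → c i ≡ suc m))
      × (∃! _≡_ (λ i → c i ≡ suc m) ⇔ (FiniteGlobalDimension c × loewyLength c ≥ suc m))
proposition4p4 m q c kupisch = mk⇔ magnitude⇒unique unique⇒magnitude , mk⇔ unique⇒loewy loewy⇒unique
  where
  open Kupisch c (kupisch-admissible q c kupisch)

  magnitude⇒unique : FiniteGlobalDimension c × MagnitudeOne c → ∃! _≡_ (λ i → c i ≡ n)
  magnitude⇒unique (fgd , magnitude) = unique-full (unit-period⇒full (magnitude-one⇒unit-period magnitude))
    where open WithMeets (FGD⇒meets fgd)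

  unique⇒magnitude : ∃! _≡_ (λ i → c i ≡ n) → FiniteGlobalDimension c × MagnitudeOne c
  unique⇒magnitude (i₀ , full , unique) =
    meets⇒FGD meets , unit-period⇒magnitude-one (period≡1⇒unit-period (period-one cycle))
    where
    open UniqueFullResidue i₀ full (λ i ci → sym (unique ci))
    open WithMeets meets

  unique⇒loewy : ∃! _≡_ (λ i → c i ≡ n) → FiniteGlobalDimension c × loewyLength c ≥ n
  unique⇒loewy u@(i₀ , full , _) = proj₁ (unique⇒magnitude u) , subst (_≤ maxFin c) full (maxFin-ub c i₀)

  loewy⇒unique : FiniteGlobalDimension c × loewyLength c ≥ n → ∃! _≡_ (λ i → c i ≡ n)
  loewy⇒unique (fgd , loewy) with maxFin-attained c
  ... | i , ci≡max = unique-full (long-loewy⇒full i (subst (n ≤_) (sym ci≡max) loewy))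
    where open WithMeets (FGD⇒meets fgd)
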